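{- Let $\mathcal{J}''(m,n)$ be the number of 001-partitions of $n$ of length $m$. Then, as formal power series in $z$ and $q$, $$\sum_{m,n\geq 0}\mathcal{J}''(m,n)\, z^m q^n = \frac{(-z^2q;q^2)_\infty}{(zq;q)_\infty\,(z^3q;q^3)_\infty\,(z^3q^2;q^3)_\infty}.$$
   Context: A 001-partition of a non-negative integer $n$ of length $m$ is a sequence $(n_1,\dots,n_m)$ of non-negative integers with $\sum_i n_i = n$, last entry $n_m \geq 1$ (when $m\ge1$), and $n_j \geq n_{j+1}-1$, $n_j \geq n_{j+2}-1$, $n_j \geq n_{j+3}$ whenever the indices are in range. The empty sequence is the unique 001-partition of length $0$ (of $n=0$). Notation: $(a;q)_\infty = \prod_{i\ge0}(1-aq^i)$. -}

module Defs where

open import Data.Nat using (ℕ; zero; suc; _+_; _*_; _∸_; _≤ᵇ_; _≡ᵇ_)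
open import Data.Bool using (Bool; true; false; _∧_; if_then_else_)
open import Data.List using (List; []; _∷_; map; concatMap; filterᵇ; length; upTo)
open import Data.Nat.ListAction using (sum)
open import Data.Integer using (ℤ) renaming (_+_ to _+ℤ_; _*_ to _*ℤ_; -_ to -ℤ_)
import Data.Integer as ℤ

gapsOK : List ℕ → Bool
gapsOK (a ∷ b ∷ c ∷ d ∷ r) =
  (b ≤ᵇ suc a) ∧ (c ≤ᵇ suc a) ∧ (d ≤ᵇ a) ∧ gapsOK (b ∷ c ∷ d ∷ r)
gapsOK (a ∷ b ∷ c ∷ []) = (b ≤ᵇ suc a) ∧ (c ≤ᵇ suc a) ∧ gapsOK (b ∷ c ∷ [])
gapsOK (a ∷ b ∷ []) = b ≤ᵇ suc a
gapsOK (a ∷ []) = true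
gapsOK [] = true

lastPos : List ℕ → Bool
lastPos [] = true
lastPos (x ∷ []) = 1 ≤ᵇ x
lastPos (x ∷ y ∷ r) = lastPos (y ∷ r)

is001 : ℕ → List ℕ → Bool
is001 n xs = (sum xs ≡ᵇ n) ∧ lastPos xs ∧ gapsOK xs

allSeqs : ℕ → ℕ → List (List ℕ)
allSeqs zero n = [] ∷ []
allSeqs (suc m) n = concatMap (λ x → map (x ∷_) (allSeqs m n)) (upTo (suc n))

-- J''(m,n): number of 001-partitions of n of length m
-- (entries of a partition of n are ≤ n, so the enumeration is exhaustive)
J'' : ℕ → ℕ → ℕ
J'' m n = length (filterᵇ (is001 n) (allSeqs m n))

-- Formal power series in z, q with integer coefficients:
-- F m n = coefficient of z^m q^n.

FPS : Set
FPS = ℕ → ℕ → ℤ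

Σ≤ : ℕ → (ℕ → ℤ) → ℤ
Σ≤ zero f = f 0
Σ≤ (suc n) f = Σ≤ n f +ℤ f (suc n)

one : FPS
one zero zero = ℤ.1ℤ
one _ _ = ℤ.0ℤ

_⊛_ : FPS → FPS → FPS
(f ⊛ g) m n = Σ≤ m (λ i → Σ≤ n (λ j → f i j *ℤ g (m ∸ i) (n ∸ j)))

prodUpTo : ℕ → (ℕ → FPS) → FPS
prodUpTo zero F = one
prodUpTo (suc N) F = prodUpTo N F ⊛ F N

onePlus : ℕ → ℕ → FPS
onePlus a b m n =
  (if (m ≡ᵇ 0) ∧ (n ≡ᵇ 0) then ℤ.1ℤ else ℤ.0ℤ) +ℤ
  (if (m ≡ᵇ a) ∧ (n ≡ᵇ b) then ℤ.1ℤ else ℤ.0ℤ)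

-- 1/(1 - z^a q^b) = Σ_{k≥0} z^{ak} q^{bk}   (used with b ≥ 1, so k ≤ n)
geom : ℕ → ℕ → FPS
geom a b m n =
  Σ≤ n (λ k → if (m ≡ᵇ a * k) ∧ (n ≡ᵇ b * k) then ℤ.1ℤ else ℤ.0ℤ)

rhsFactor : ℕ → FPS
rhsFactor i =
  ((onePlus 2 (2 * i + 1) ⊛ geom 1 (i + 1)) ⊛ geom 3 (3 * i + 1)) ⊛ geom 3 (3 * i + 2)

-- The infinite product (-z^2q;q^2)_∞ / ((zq;q)_∞ (z^3q;q^3)_∞ (z^3q^2;q^3)_∞)
-- as a formal power series: every factor with index i ≥ n+1 is 1 + O(q^{n+1}),
-- so the coefficient of z^m q^n is that of the finite product over i ≤ n.
rhs : FPS
rhs m n = prodUpTo (suc n) rhsFactor m n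

-- Let V_N count the 001-partitions with all entries ≤ N.  Then V_0 = 1, and J''(m, n) is the
-- coefficient of z^m q^n in V_(n+1), since no entry of a partition of n exceeds n.  A 001-partition
-- with entries ≤ N + 1 factors uniquely as
--   (N+1)^a (N, N+1, N+1)^b (N, N+1)^ε (N, N, N+1)^c w,   ε ∈ {0, 1},
-- with w a 001-partition with entries ≤ N.  Stripping the blocks one kind at a time, each stage X
-- satisfies X = Y + z^|β| q^Σβ X or X = Y + z^|β| q^Σβ Y, and the former has the unique solution
-- Y / (1 - z^|β| q^Σβ).  Hence V_(N+1) = V_N (1 + z²q^(2N+1)) / ((1 - zq^(N+1))(1 - z³q^(3N+1))(1 - z³q^(3N+2))),
-- and induction on N gives the product.  Associativity of the Cauchy product is only needed
-- against these four factors, where it also follows from the uniqueness of such solutions.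

{-# OPTIONS --safe #-}
module Submission where

open import Defs

open import Data.Bool using (Bool; true; false; T; _∧_; if_then_else_)
open import Data.Bool.Properties using (∧-zeroʳ; T-∧)
open import Data.Integer using (ℤ; +_; 0ℤ; 1ℤ) renaming (_+_ to _+ℤ_; _*_ to _*ℤ_; _-_ to _-ℤ_)
import Data.Integer.Properties as ℤ
open import Algebra.Properties.CommutativeSemigroup ℤ.+-commutativeSemigroup using (interchange)
open import Data.Integer.Tactic.RingSolver using (solve-∀)
open import Data.List using (List; []; _∷_; _++_; drop; length; map; concatMap; filterᵇ; applyUpTo)
import Data.List.Properties as List
open import Data.List.Relation.Binary.Prefix.Heterogeneous using (Prefix; []; _∷_)
open import Data.List.Relation.Binary.Prefix.Heterogeneous.Properties using (length-mono; prefix?)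
open import Data.List.Relation.Unary.All as All using (All; []; _∷_; all?)
open import Data.List.Relation.Unary.All.Properties using (drop⁺)
open import Data.Nat using (ℕ; zero; suc; _+_; _*_; _∸_; _≤_; _<_; _≤ᵇ_; _≡ᵇ_; z≤n; s≤s; z<s; >-nonZero)
open import Data.Nat.Induction using (<-rec)
open import Data.Nat.ListAction using (sum)
open import Data.Nat.ListAction.Properties using (sum-++)
open import Data.Nat.Properties as ℕ using (_≟_; _≤?_)
open import Data.Product using (_×_; _,_; proj₁; proj₂)
open import Data.Product.Function.NonDependent.Propositional using (_×-⇔_)
open import Data.Sum using (_⊎_; inj₁; inj₂)
open import Data.Unit using (⊤; tt)
open import Function using (_∘_; _⇔_; mk⇔; Equivalence)
open import Function.Properties.Equivalence using () renaming (refl to ⇔-refl; trans to ⇔-trans)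
open import Level using (0ℓ)
open import Relation.Binary using (Setoid)
import Relation.Binary.Reasoning.Setoid as SetoidReasoning
open import Relation.Binary.PropositionalEquality
open import Relation.Nullary using (¬_; Dec; yes; no; does; contradiction)
open import Relation.Nullary.Decidable using (T?; ¬?; _×-dec_; dec-true; dec-false; does-⇔)
import Relation.Nullary.Decidable as Dec
open import Relation.Unary using (Pred; Decidable)

-- Finite sums

Σ≤-cong : ∀ n {f g : ℕ → ℤ} → (∀ i → i ≤ n → f i ≡ g i) → Σ≤ n f ≡ Σ≤ n g
Σ≤-cong zero    f≗g = f≗g 0 z≤n
Σ≤-cong (suc n) f≗g = cong₂ _+ℤ_ (Σ≤-cong n (λ i i≤n → f≗g i (ℕ.m≤n⇒m≤1+n i≤n))) (f≗g (suc n) ℕ.≤-refl)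

Σ≤-zero : ∀ n {f : ℕ → ℤ} → (∀ i → i ≤ n → f i ≡ 0ℤ) → Σ≤ n f ≡ 0ℤ
Σ≤-zero zero    f≗0 = f≗0 0 z≤n
Σ≤-zero (suc n) f≗0 = cong₂ _+ℤ_ (Σ≤-zero n (λ i i≤n → f≗0 i (ℕ.m≤n⇒m≤1+n i≤n))) (f≗0 (suc n) ℕ.≤-refl)

Σ≤-distrib-+ : ∀ n (f g : ℕ → ℤ) → Σ≤ n (λ i → f i +ℤ g i) ≡ Σ≤ n f +ℤ Σ≤ n g
Σ≤-distrib-+ zero    f g = refl
Σ≤-distrib-+ (suc n) f g = trans (cong (_+ℤ (f (suc n) +ℤ g (suc n))) (Σ≤-distrib-+ n f g))
                                 (interchange (Σ≤ n f) (Σ≤ n g) (f (suc n)) (g (suc n)))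

Σ≤-suc : ∀ n (f : ℕ → ℤ) → Σ≤ (suc n) f ≡ f 0 +ℤ Σ≤ n (λ i → f (suc i))
Σ≤-suc zero    f = refl
Σ≤-suc (suc n) f = trans (cong (_+ℤ f (2 + n)) (Σ≤-suc n f)) (ℤ.+-assoc (f 0) _ _)

Σ≤-reverse : ∀ n (f : ℕ → ℤ) → Σ≤ n f ≡ Σ≤ n (λ i → f (n ∸ i))
Σ≤-reverse zero    f = refl
Σ≤-reverse (suc n) f = begin
  Σ≤ n f +ℤ f (suc n)                  ≡⟨ cong (_+ℤ f (suc n)) (Σ≤-reverse n f) ⟩
  Σ≤ n (λ i → f (n ∸ i)) +ℤ f (suc n)  ≡⟨ ℤ.+-comm _ (f (suc n)) ⟩
  f (suc n) +ℤ Σ≤ n (λ i → f (n ∸ i))  ≡⟨ Σ≤-suc n (λ i → f (suc n ∸ i)) ⟨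
  Σ≤ (suc n) (λ i → f (suc n ∸ i))     ∎
  where open ≡-Reasoning

Σ≤-truncate : ∀ {k} n (f : ℕ → ℤ) → k ≤ n → (∀ i → k < i → i ≤ n → f i ≡ 0ℤ) → Σ≤ n f ≡ Σ≤ k f
Σ≤-truncate n f k≤n f≗0 with ℕ.m≤n⇒m<n∨m≡n k≤n
... | inj₂ refl = refl
Σ≤-truncate (suc n) f k≤n f≗0 | inj₁ (s≤s k≤n′) =
  trans (cong₂ _+ℤ_ (Σ≤-truncate n f k≤n′ (λ i k<i i≤n → f≗0 i k<i (ℕ.m≤n⇒m≤1+n i≤n)))
                    (f≗0 (suc n) (s≤s k≤n′) ℕ.≤-refl))
        (ℤ.+-identityʳ _)

Σ≤-single : ∀ {b} n (f : ℕ → ℤ) → b ≤ n → (∀ i → i ≤ n → i ≢ b → f i ≡ 0ℤ) → Σ≤ n f ≡ f b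
Σ≤-single {b} n f b≤n f≗0 =
  trans (Σ≤-truncate n f b≤n (λ i b<i i≤n → f≗0 i i≤n (ℕ.>⇒≢ b<i)))
        (Σ≤-last b (λ i i<b → f≗0 i (ℕ.<⇒≤ (ℕ.<-≤-trans i<b b≤n)) (ℕ.<⇒≢ i<b)))
  where
  Σ≤-last : ∀ b → (∀ i → i < b → f i ≡ 0ℤ) → Σ≤ b f ≡ f b
  Σ≤-last zero    _   = refl
  Σ≤-last (suc b) f≗0 =
    trans (cong (_+ℤ f (suc b)) (Σ≤-zero b (λ i i≤b → f≗0 i (s≤s i≤b)))) (ℤ.+-identityˡ _)

Σ≤-shift : ∀ {a m} → a ≤ m → (F : ℕ → ℕ → ℤ) → (∀ i k → k < a → F i k ≡ 0ℤ) →
           Σ≤ m (λ i → F i (m ∸ i)) ≡ Σ≤ (m ∸ a) (λ i → F i (a + (m ∸ a ∸ i)))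
Σ≤-shift {a} {m} a≤m F F≗0 = begin
  Σ≤ m (λ i → F i (m ∸ i))
    ≡⟨ Σ≤-truncate m _ (ℕ.m∸n≤m m a) (λ i m∸a<i i≤m → F≗0 i (m ∸ i) (m∸i<a m∸a<i i≤m)) ⟩
  Σ≤ (m ∸ a) (λ i → F i (m ∸ i))
    ≡⟨ Σ≤-cong (m ∸ a) (λ i i≤m∸a → cong (F i) (m∸i≡a+[m∸a∸i] i≤m∸a)) ⟩
  Σ≤ (m ∸ a) (λ i → F i (a + (m ∸ a ∸ i))) ∎
  where
  open ≡-Reasoning
  m∸i<a : ∀ {i} → m ∸ a < i → i ≤ m → m ∸ i < a
  m∸i<a {i} m∸a<i i≤m = ℕ.≰⇒> (λ a≤m∸i → ℕ.<⇒≱ m∸a<i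
    (ℕ.m+n≤o⇒m≤o∸n i (subst (_≤ m) (ℕ.+-comm a i) (ℕ.m≤o∸n⇒m+n≤o a i≤m a≤m∸i))))
  m∸i≡a+[m∸a∸i] : ∀ {i} → i ≤ m ∸ a → m ∸ i ≡ a + (m ∸ a ∸ i)
  m∸i≡a+[m∸a∸i] {i} i≤m∸a = begin
    m ∸ i               ≡⟨ cong (_∸ i) (ℕ.m+[n∸m]≡n a≤m) ⟨
    a + (m ∸ a) ∸ i     ≡⟨ ℕ.+-∸-assoc a i≤m∸a ⟩
    a + (m ∸ a ∸ i)     ∎

-- Formal power series

infix 4 _≋_
_≋_ : FPS → FPS → Set
f ≋ g = ∀ m n → f m n ≡ g m n

≋-setoid : Setoid _ _
≋-setoid = record
  { Carrier       = FPS
  ; _≈_           = _≋_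
  ; isEquivalence = record
    { refl  = λ _ _ → refl
    ; sym   = λ f≋g m n → sym (f≋g m n)
    ; trans = λ f≋g g≋h m n → trans (f≋g m n) (g≋h m n)
    }
  }

module ≋-Reasoning = SetoidReasoning ≋-setoid

infixl 6 _⊕_
_⊕_ : FPS → FPS → FPS
(f ⊕ g) m n = f m n +ℤ g m n

⊕-cong : ∀ {f f′ g g′} → f ≋ f′ → g ≋ g′ → f ⊕ g ≋ f′ ⊕ g′
⊕-cong f≋f′ g≋g′ m n = cong₂ _+ℤ_ (f≋f′ m n) (g≋g′ m n)

-- multiplication by the monomial z^a q^b
shift : ℕ → ℕ → FPS → FPS
shift a b f m n = if (a ≤ᵇ m) ∧ (b ≤ᵇ n) then f (m ∸ a) (n ∸ b) else 0ℤ

shift-≤ : ∀ {a b m n} f → a ≤ m → b ≤ n → shift a b f m n ≡ f (m ∸ a) (n ∸ b)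
shift-≤ {a} {b} {m} {n} f a≤m b≤n =
  cong (if_then f (m ∸ a) (n ∸ b) else 0ℤ) (dec-true (a ≤? m ×-dec b ≤? n) (a≤m , b≤n))

shift-≰ : ∀ {a b m n} f → ¬ (a ≤ m × b ≤ n) → shift a b f m n ≡ 0ℤ
shift-≰ {a} {b} {m} {n} f ≰ =
  cong (if_then f (m ∸ a) (n ∸ b) else 0ℤ) (dec-false (a ≤? m ×-dec b ≤? n) ≰)

shift-+ : ∀ {a b} f k l → shift a b f (a + k) (b + l) ≡ f k l
shift-+ {a} {b} f k l = trans (shift-≤ f (ℕ.m≤m+n a k) (ℕ.m≤m+n b l))
                              (cong₂ f (ℕ.m+n∸m≡n a k) (ℕ.m+n∸m≡n b l))

shift-cong : ∀ a b {f g} → f ≋ g → shift a b f ≋ shift a b g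
shift-cong a b f≋g m n =
  cong (if (a ≤ᵇ m) ∧ (b ≤ᵇ n) then_else 0ℤ) (f≋g (m ∸ a) (n ∸ b))

shift-cong-< : ∀ {a b n f g} m → 0 < b → (∀ m′ n′ → n′ < n → f m′ n′ ≡ g m′ n′) →
               shift a b f m n ≡ shift a b g m n
shift-cong-< {a} {b} {n} {f} {g} m b>0 f≗g with a ≤? m ×-dec b ≤? n
... | yes (a≤m , b≤n) = begin
  shift a b f m n         ≡⟨ shift-≤ f a≤m b≤n ⟩
  f (m ∸ a) (n ∸ b)       ≡⟨ f≗g (m ∸ a) (n ∸ b) (ℕ.∸-monoʳ-< b>0 b≤n) ⟩
  g (m ∸ a) (n ∸ b)       ≡⟨ shift-≤ g a≤m b≤n ⟨
  shift a b g m n         ∎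
  where open ≡-Reasoning
... | no ≰ = trans (shift-≰ f ≰) (sym (shift-≰ g ≰))

shift-fixpoint-unique : ∀ a b X X′ Y → 0 < b →
  X ≋ Y ⊕ shift a b X → X′ ≋ Y ⊕ shift a b X′ → X ≋ X′
shift-fixpoint-unique a b X X′ Y b>0 X≋ X′≋ m n =
  <-rec (λ n → ∀ m → X m n ≡ X′ m n) step n m
  where
  open ≡-Reasoning
  step : ∀ n → (∀ {n′} → n′ < n → ∀ m → X m n′ ≡ X′ m n′) → ∀ m → X m n ≡ X′ m n
  step n ih m = begin
    X m n
      ≡⟨ X≋ m n ⟩
    Y m n +ℤ shift a b X m n
      ≡⟨ cong (Y m n +ℤ_) (shift-cong-< {a} {f = X} {X′} m b>0 (λ m′ _ n′<n → ih n′<n m′)) ⟩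
    Y m n +ℤ shift a b X′ m n
      ≡⟨ X′≋ m n ⟨
    X′ m n ∎

⊛-cong : ∀ {f f′ g g′} → f ≋ f′ → g ≋ g′ → f ⊛ g ≋ f′ ⊛ g′
⊛-cong f≋f′ g≋g′ m n =
  Σ≤-cong m (λ i _ → Σ≤-cong n (λ j _ → cong₂ _*ℤ_ (f≋f′ i j) (g≋g′ (m ∸ i) (n ∸ j))))

⊛-congˡ : ∀ {f f′} g → f ≋ f′ → f ⊛ g ≋ f′ ⊛ g
⊛-congˡ g f≋f′ = ⊛-cong {g = g} f≋f′ (λ _ _ → refl)

⊛-congʳ : ∀ f {g g′} → g ≋ g′ → f ⊛ g ≋ f ⊛ g′
⊛-congʳ f = ⊛-cong {f} (λ _ _ → refl)

⊛-comm : ∀ f g → f ⊛ g ≋ g ⊛ f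
⊛-comm f g m n = begin
  Σ≤ m (λ i → Σ≤ n (λ j → f i j *ℤ g (m ∸ i) (n ∸ j)))
    ≡⟨ Σ≤-reverse m _ ⟩
  Σ≤ m (λ i → Σ≤ n (λ j → f (m ∸ i) j *ℤ g (m ∸ (m ∸ i)) (n ∸ j)))
    ≡⟨ Σ≤-cong m (λ i _ → Σ≤-reverse n _) ⟩
  Σ≤ m (λ i → Σ≤ n (λ j → f (m ∸ i) (n ∸ j) *ℤ g (m ∸ (m ∸ i)) (n ∸ (n ∸ j))))
    ≡⟨ Σ≤-cong m (λ i i≤m → Σ≤-cong n (λ j j≤n →
         trans (cong₂ (λ x y → f (m ∸ i) (n ∸ j) *ℤ g x y) (ℕ.m∸[m∸n]≡n i≤m) (ℕ.m∸[m∸n]≡n j≤n))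
               (ℤ.*-comm (f (m ∸ i) (n ∸ j)) (g i j)))) ⟩
  Σ≤ m (λ i → Σ≤ n (λ j → g i j *ℤ f (m ∸ i) (n ∸ j))) ∎
  where open ≡-Reasoning

one-≢0 : ∀ {k l} → k ≢ 0 ⊎ l ≢ 0 → one k l ≡ 0ℤ
one-≢0 {zero}  {zero}  (inj₁ k≢0) = contradiction refl k≢0
one-≢0 {zero}  {zero}  (inj₂ l≢0) = contradiction refl l≢0
one-≢0 {zero}  {suc l} _          = refl
one-≢0 {suc k}         _          = refl

⊛-identityʳ : ∀ f → f ⊛ one ≋ f
⊛-identityʳ f m n = begin
  Σ≤ m (λ i → Σ≤ n (λ j → f i j *ℤ one (m ∸ i) (n ∸ j)))
    ≡⟨ Σ≤-single m _ ℕ.≤-refl (λ i i≤m i≢m → Σ≤-zero n (λ j _ →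
         vanish (inj₁ (ℕ.m>n⇒m∸n≢0 (ℕ.≤∧≢⇒< i≤m i≢m))))) ⟩
  Σ≤ n (λ j → f m j *ℤ one (m ∸ m) (n ∸ j))
    ≡⟨ Σ≤-single n _ ℕ.≤-refl (λ j j≤n j≢n →
         vanish (inj₂ (ℕ.m>n⇒m∸n≢0 (ℕ.≤∧≢⇒< j≤n j≢n)))) ⟩
  f m n *ℤ one (m ∸ m) (n ∸ n)
    ≡⟨ cong₂ (λ x y → f m n *ℤ one x y) (ℕ.n∸n≡0 m) (ℕ.n∸n≡0 n) ⟩
  f m n *ℤ 1ℤ
    ≡⟨ ℤ.*-identityʳ (f m n) ⟩
  f m n ∎
  where
  open ≡-Reasoning
  vanish : ∀ {x y k l} → k ≢ 0 ⊎ l ≢ 0 → f x y *ℤ one k l ≡ 0ℤ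
  vanish {x} {y} k,l≢0 = trans (cong (f x y *ℤ_) (one-≢0 k,l≢0)) (ℤ.*-zeroʳ (f x y))

⊛-distribˡ-⊕ : ∀ f g h → f ⊛ (g ⊕ h) ≋ f ⊛ g ⊕ f ⊛ h
⊛-distribˡ-⊕ f g h m n = trans
  (Σ≤-cong m (λ i _ → trans (Σ≤-cong n (λ j _ → ℤ.*-distribˡ-+ (f i j) _ _)) (Σ≤-distrib-+ n _ _)))
  (Σ≤-distrib-+ m _ _)

⊛-shiftʳ : ∀ a b f g → f ⊛ shift a b g ≋ shift a b (f ⊛ g)
⊛-shiftʳ a b f g m n with a ≤? m ×-dec b ≤? n
... | yes (a≤m , b≤n) = begin
  Σ≤ m (λ i → Σ≤ n (λ j → f i j *ℤ shift a b g (m ∸ i) (n ∸ j)))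
    ≡⟨ Σ≤-shift a≤m (λ i k → Σ≤ n (λ j → f i j *ℤ shift a b g k (n ∸ j)))
                    (λ i k k<a → Σ≤-zero n (λ j _ → vanish (λ (a≤k , _) → ℕ.<⇒≱ k<a a≤k))) ⟩
  Σ≤ (m ∸ a) (λ i → Σ≤ n (λ j → f i j *ℤ shift a b g (a + (m ∸ a ∸ i)) (n ∸ j)))
    ≡⟨ Σ≤-cong (m ∸ a) (λ i _ → Σ≤-shift b≤n (λ j l → f i j *ℤ shift a b g (a + (m ∸ a ∸ i)) l)
                                              (λ j l l<b → vanish (λ (_ , b≤l) → ℕ.<⇒≱ l<b b≤l))) ⟩
  Σ≤ (m ∸ a) (λ i → Σ≤ (n ∸ b) (λ j → f i j *ℤ shift a b g (a + (m ∸ a ∸ i)) (b + (n ∸ b ∸ j))))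
    ≡⟨ Σ≤-cong (m ∸ a) (λ i _ → Σ≤-cong (n ∸ b) (λ j _ → cong (f i j *ℤ_) (shift-+ {a} {b} g _ _))) ⟩
  (f ⊛ g) (m ∸ a) (n ∸ b)
    ≡⟨ shift-≤ (f ⊛ g) a≤m b≤n ⟨
  shift a b (f ⊛ g) m n ∎
  where
  open ≡-Reasoning
  vanish : ∀ {i j k l} → ¬ (a ≤ k × b ≤ l) → f i j *ℤ shift a b g k l ≡ 0ℤ
  vanish {i} {j} ≰ = trans (cong (f i j *ℤ_) (shift-≰ g ≰)) (ℤ.*-zeroʳ (f i j))
... | no ≰ = trans (Σ≤-zero m (λ i _ → Σ≤-zero n (λ j _ → vanish i j)))
                   (sym (shift-≰ (f ⊛ g) ≰))
  where
  vanish : ∀ i j → f i j *ℤ shift a b g (m ∸ i) (n ∸ j) ≡ 0ℤ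
  vanish i j = trans (cong (f i j *ℤ_) (shift-≰ g (λ (a≤ , b≤) →
                       ≰ (ℕ.≤-trans a≤ (ℕ.m∸n≤m m i) , ℕ.≤-trans b≤ (ℕ.m∸n≤m n j)))))
                     (ℤ.*-zeroʳ (f i j))

⟦_⟧ : Bool → ℤ
⟦ b ⟧ = if b then 1ℤ else 0ℤ

-- geom and onePlus are, definitionally, sums of these monomials
mono : ℕ → ℕ → FPS
mono a b m n = ⟦ (m ≡ᵇ a) ∧ (n ≡ᵇ b) ⟧

mono-zero : mono 0 0 ≋ one
mono-zero zero    zero    = refl
mono-zero zero    (suc n) = refl
mono-zero (suc m) n       = refl

≡+⇔∸≡ : ∀ {a c m} → a ≤ m → (m ≡ a + c) ⇔ (m ∸ a ≡ c)
≡+⇔∸≡ {a} {c} a≤m = mk⇔ (λ m≡a+c → trans (cong (_∸ a) m≡a+c) (ℕ.m+n∸m≡n a c))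
                        (λ m∸a≡c → trans (sym (ℕ.m+[n∸m]≡n a≤m)) (cong (λ x → a + x) m∸a≡c))

mono-+ : ∀ a b c d → mono (a + c) (b + d) ≋ shift a b (mono c d)
mono-+ a b c d m n with a ≤? m ×-dec b ≤? n
... | yes (a≤m , b≤n) = trans
  (cong ⟦_⟧ (does-⇔ (≡+⇔∸≡ a≤m ×-⇔ ≡+⇔∸≡ b≤n)
                    (m ≟ a + c ×-dec n ≟ b + d) (m ∸ a ≟ c ×-dec n ∸ b ≟ d)))
  (sym (shift-≤ (mono c d) a≤m b≤n))
... | no ≰ = trans
  (cong ⟦_⟧ (dec-false (m ≟ a + c ×-dec n ≟ b + d)
    (λ (m≡a+c , n≡b+d) →
       ≰ (subst (a ≤_) (sym m≡a+c) (ℕ.m≤m+n a c) , subst (b ≤_) (sym n≡b+d) (ℕ.m≤m+n b d)))))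
  (sym (shift-≰ (mono c d) ≰))

geom-term-zero : ∀ a b → mono (a * 0) (b * 0) ≋ one
geom-term-zero a b m n = trans (cong₂ (λ x y → mono x y m n) (ℕ.*-zeroʳ a) (ℕ.*-zeroʳ b)) (mono-zero m n)

geom-term-suc : ∀ a b k → mono (a * suc k) (b * suc k) ≋ shift a b (mono (a * k) (b * k))
geom-term-suc a b k m n =
  trans (cong₂ (λ x y → mono x y m n) (ℕ.*-suc a k) (ℕ.*-suc b k)) (mono-+ a b (a * k) (b * k) m n)

geom-term-vanish : ∀ {a b k m n} → 0 < b → n < k → mono (a * k) (b * k) m n ≡ 0ℤ
geom-term-vanish {a} {b} {k} {m} {n} b>0 n<k = cong ⟦_⟧ (dec-false (m ≟ a * k ×-dec n ≟ b * k)
  (λ (_ , n≡bk) → ℕ.<⇒≢ (ℕ.<-≤-trans n<k (ℕ.m≤n*m k b {{>-nonZero b>0}})) n≡bk))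

geom-unfold : ∀ a b → 0 < b → geom a b ≋ one ⊕ shift a b (geom a b)
geom-unfold a b b>0 m zero = begin
  mono (a * 0) (b * 0) m 0
    ≡⟨ geom-term-zero a b m 0 ⟩
  one m 0
    ≡⟨ ℤ.+-identityʳ (one m 0) ⟨
  one m 0 +ℤ 0ℤ
    ≡⟨ cong (one m 0 +ℤ_) (shift-≰ {a} {m = m} (geom a b) (λ (_ , b≤0) → ℕ.<⇒≱ b>0 b≤0)) ⟨
  one m 0 +ℤ shift a b (geom a b) m 0 ∎
  where open ≡-Reasoning
geom-unfold a b b>0 m (suc n) = begin
  Σ≤ (suc n) (λ k → mono (a * k) (b * k) m (suc n))
    ≡⟨ Σ≤-suc n _ ⟩
  mono (a * 0) (b * 0) m (suc n) +ℤ Σ≤ n (λ k → mono (a * suc k) (b * suc k) m (suc n))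
    ≡⟨ cong₂ _+ℤ_ (geom-term-zero a b m (suc n)) (Σ≤-cong n (λ k _ → geom-term-suc a b k m (suc n))) ⟩
  one m (suc n) +ℤ Σ≤ n (λ k → shift a b (mono (a * k) (b * k)) m (suc n))
    ≡⟨ cong (one m (suc n) +ℤ_) shifted-terms ⟩
  one m (suc n) +ℤ shift a b (geom a b) m (suc n) ∎
  where
  open ≡-Reasoning
  shifted-terms : Σ≤ n (λ k → shift a b (mono (a * k) (b * k)) m (suc n)) ≡ shift a b (geom a b) m (suc n)
  shifted-terms with a ≤? m ×-dec b ≤? suc n
  ... | yes (a≤m , b≤1+n) = begin
    Σ≤ n (λ k → shift a b (mono (a * k) (b * k)) m (suc n))
      ≡⟨ Σ≤-cong n (λ k _ → shift-≤ (mono (a * k) (b * k)) a≤m b≤1+n) ⟩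
    Σ≤ n (λ k → mono (a * k) (b * k) (m ∸ a) (suc n ∸ b))
      ≡⟨ Σ≤-truncate n _ (ℕ.∸-monoʳ-≤ (suc n) b>0) (λ k lt _ → geom-term-vanish {a} {m = m ∸ a} b>0 lt) ⟩
    geom a b (m ∸ a) (suc n ∸ b)
      ≡⟨ shift-≤ (geom a b) a≤m b≤1+n ⟨
    shift a b (geom a b) m (suc n) ∎
  ... | no ≰ = trans (Σ≤-zero n (λ k _ → shift-≰ (mono (a * k) (b * k)) ≰)) (sym (shift-≰ (geom a b) ≰))

onePlus-unfold : ∀ a b → onePlus a b ≋ one ⊕ shift a b one
onePlus-unfold a b m n = cong₂ _+ℤ_ (mono-zero m n) (begin
  mono a b m n                 ≡⟨ cong₂ (λ x y → mono x y m n) (ℕ.+-identityʳ a) (ℕ.+-identityʳ b) ⟨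
  mono (a + 0) (b + 0) m n     ≡⟨ mono-+ a b 0 0 m n ⟩
  shift a b (mono 0 0) m n     ≡⟨ shift-cong a b mono-zero m n ⟩
  shift a b one m n            ∎)
  where open ≡-Reasoning

⊛-geom-unfold : ∀ a b → 0 < b → ∀ f → f ⊛ geom a b ≋ f ⊕ shift a b (f ⊛ geom a b)
⊛-geom-unfold a b b>0 f = begin
  f ⊛ geom a b                           ≈⟨ ⊛-congʳ f (geom-unfold a b b>0) ⟩
  f ⊛ (one ⊕ shift a b (geom a b))       ≈⟨ ⊛-distribˡ-⊕ f one (shift a b (geom a b)) ⟩
  f ⊛ one ⊕ f ⊛ shift a b (geom a b)     ≈⟨ ⊕-cong (⊛-identityʳ f) (⊛-shiftʳ a b f (geom a b)) ⟩
  f ⊕ shift a b (f ⊛ geom a b)           ∎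
  where open ≋-Reasoning

⊛-onePlus : ∀ a b f → f ⊛ onePlus a b ≋ f ⊕ shift a b f
⊛-onePlus a b f = begin
  f ⊛ onePlus a b                  ≈⟨ ⊛-congʳ f (onePlus-unfold a b) ⟩
  f ⊛ (one ⊕ shift a b one)        ≈⟨ ⊛-distribˡ-⊕ f one (shift a b one) ⟩
  f ⊛ one ⊕ f ⊛ shift a b one      ≈⟨ ⊕-cong (⊛-identityʳ f) (⊛-shiftʳ a b f one) ⟩
  f ⊕ shift a b (f ⊛ one)          ≈⟨ ⊕-cong {f} (λ _ _ → refl) (shift-cong a b (⊛-identityʳ f)) ⟩
  f ⊕ shift a b f                  ∎
  where open ≋-Reasoning

shift-fixpoint⇒⊛-geom : ∀ a b X Y → 0 < b → X ≋ Y ⊕ shift a b X → X ≋ Y ⊛ geom a b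
shift-fixpoint⇒⊛-geom a b X Y b>0 X≋ = shift-fixpoint-unique a b X (Y ⊛ geom a b) Y b>0 X≋ (⊛-geom-unfold a b b>0 Y)

RightAssociative : FPS → Set
RightAssociative h = ∀ f g → f ⊛ (g ⊛ h) ≋ (f ⊛ g) ⊛ h

geom-rightAssociative : ∀ a b → 0 < b → RightAssociative (geom a b)
geom-rightAssociative a b b>0 f g = shift-fixpoint⇒⊛-geom a b (f ⊛ (g ⊛ geom a b)) (f ⊛ g) b>0 (begin
  f ⊛ (g ⊛ geom a b)                         ≈⟨ ⊛-congʳ f (⊛-geom-unfold a b b>0 g) ⟩
  f ⊛ (g ⊕ shift a b (g ⊛ geom a b))         ≈⟨ ⊛-distribˡ-⊕ f g (shift a b (g ⊛ geom a b)) ⟩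
  f ⊛ g ⊕ f ⊛ shift a b (g ⊛ geom a b)       ≈⟨ ⊕-cong {f ⊛ g} (λ _ _ → refl) (⊛-shiftʳ a b f (g ⊛ geom a b)) ⟩
  f ⊛ g ⊕ shift a b (f ⊛ (g ⊛ geom a b))     ∎)
  where open ≋-Reasoning

onePlus-rightAssociative : ∀ a b → RightAssociative (onePlus a b)
onePlus-rightAssociative a b f g = begin
  f ⊛ (g ⊛ onePlus a b)              ≈⟨ ⊛-congʳ f (⊛-onePlus a b g) ⟩
  f ⊛ (g ⊕ shift a b g)              ≈⟨ ⊛-distribˡ-⊕ f g (shift a b g) ⟩
  f ⊛ g ⊕ f ⊛ shift a b g            ≈⟨ ⊕-cong {f ⊛ g} (λ _ _ → refl) (⊛-shiftʳ a b f g) ⟩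
  f ⊛ g ⊕ shift a b (f ⊛ g)          ≈⟨ ⊛-onePlus a b (f ⊛ g) ⟨
  (f ⊛ g) ⊛ onePlus a b              ∎
  where open ≋-Reasoning

⊛-swap : ∀ h h′ → RightAssociative h → RightAssociative h′ → ∀ f → (f ⊛ h) ⊛ h′ ≋ (f ⊛ h′) ⊛ h
⊛-swap h h′ assoc assoc′ f = begin
  (f ⊛ h) ⊛ h′     ≈⟨ assoc′ f h ⟨
  f ⊛ (h ⊛ h′)     ≈⟨ ⊛-congʳ f (⊛-comm h h′) ⟩
  f ⊛ (h′ ⊛ h)     ≈⟨ assoc f h′ ⟩
  (f ⊛ h′) ⊛ h     ∎
  where open ≋-Reasoning

-- Sums over bounded sequences

Σseq : ℕ → ℕ → (List ℕ → ℤ) → ℤ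
Σseq zero    M f = f []
Σseq (suc m) M f = Σ≤ M (λ x → Σseq m M (λ L → f (x ∷ L)))

Σseq-cong : ∀ m M {f g : List ℕ → ℤ} → (∀ L → length L ≡ m → All (_≤ M) L → f L ≡ g L) →
            Σseq m M f ≡ Σseq m M g
Σseq-cong zero    M f≗g = f≗g [] refl []
Σseq-cong (suc m) M f≗g = Σ≤-cong M (λ x x≤M → Σseq-cong m M (λ L |L|≡m L≤M →
  f≗g (x ∷ L) (cong suc |L|≡m) (x≤M ∷ L≤M)))

Σseq-zero : ∀ m M {f : List ℕ → ℤ} → (∀ L → length L ≡ m → All (_≤ M) L → f L ≡ 0ℤ) →
            Σseq m M f ≡ 0ℤ
Σseq-zero zero    M f≗0 = f≗0 [] refl []
Σseq-zero (suc m) M f≗0 = Σ≤-zero M (λ x x≤M → Σseq-zero m M (λ L |L|≡m L≤M →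
  f≗0 (x ∷ L) (cong suc |L|≡m) (x≤M ∷ L≤M)))

Σseq-distrib-+ : ∀ m M (f g : List ℕ → ℤ) → Σseq m M (λ L → f L +ℤ g L) ≡ Σseq m M f +ℤ Σseq m M g
Σseq-distrib-+ zero    M f g = refl
Σseq-distrib-+ (suc m) M f g =
  trans (Σ≤-cong M (λ x _ → Σseq-distrib-+ m M _ _)) (Σ≤-distrib-+ M _ _)

Σseq-prefix : ∀ {M m} β (h : List ℕ → ℤ) → All (_≤ M) β → length β ≤ m →
  (∀ L → All (_≤ M) L → ¬ Prefix _≡_ β L → h L ≡ 0ℤ) →
  Σseq m M h ≡ Σseq (m ∸ length β) M (λ r → h (β ++ r))
Σseq-prefix []      h _ _ _ = refl
Σseq-prefix {M} {suc m} (b ∷ β) h (b≤M ∷ β≤M) (s≤s |β|≤m) h≗0 = begin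
  Σ≤ M (λ x → Σseq m M (λ L → h (x ∷ L)))
    ≡⟨ Σ≤-single M _ b≤M (λ x x≤M x≢b → Σseq-zero m M (λ L _ L≤M →
         h≗0 (x ∷ L) (x≤M ∷ L≤M) (λ { (b≡x ∷ _) → x≢b (sym b≡x) }))) ⟩
  Σseq m M (λ L → h (b ∷ L))
    ≡⟨ Σseq-prefix β (λ L → h (b ∷ L)) β≤M |β|≤m (λ L L≤M ¬β≼L →
         h≗0 (b ∷ L) (b≤M ∷ L≤M) (λ { (_ ∷ β≼L) → ¬β≼L β≼L })) ⟩
  Σseq (m ∸ length β) M (λ r → h (b ∷ β ++ r)) ∎
  where open ≡-Reasoning

Σseq-restrict : ∀ m M (f : List ℕ → ℤ) → (∀ L → All (_≤ suc M) L → ¬ All (_≤ M) L → f L ≡ 0ℤ) →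
                Σseq m (suc M) f ≡ Σseq m M f
Σseq-restrict zero    M f f≗0 = refl
Σseq-restrict (suc m) M f f≗0 = trans
  (cong₂ _+ℤ_
    (Σ≤-cong M (λ x x≤M → Σseq-restrict m M _ (λ L L≤1+M ¬L≤M →
      f≗0 (x ∷ L) (ℕ.m≤n⇒m≤1+n x≤M ∷ L≤1+M) (λ { (_ ∷ L≤M) → ¬L≤M L≤M }))))
    (Σseq-zero m (suc M) (λ L _ L≤1+M →
      f≗0 (suc M ∷ L) (ℕ.≤-refl ∷ L≤1+M) (λ { (1+M≤M ∷ _) → ℕ.1+n≰n 1+M≤M }))))
  (ℤ.+-identityʳ _)

length-filterᵇ-map : ∀ (p : List ℕ → Bool) f (xs : List (List ℕ)) →
                     length (filterᵇ p (map f xs)) ≡ length (filterᵇ (p ∘ f) xs)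
length-filterᵇ-map p f []       = refl
length-filterᵇ-map p f (x ∷ xs) with p (f x)
... | true  = cong suc (length-filterᵇ-map p f xs)
... | false = length-filterᵇ-map p f xs

length-filterᵇ-concatMap : ∀ (p : List ℕ → Bool) (g : ℕ → List (List ℕ)) M f →
  + length (filterᵇ p (concatMap g (applyUpTo f (suc M)))) ≡ Σ≤ M (λ x → + length (filterᵇ p (g (f x))))
length-filterᵇ-concatMap p g zero    f = cong (λ xs → + length (filterᵇ p xs)) (List.++-identityʳ (g (f 0)))
length-filterᵇ-concatMap p g (suc M) f = begin
  + length (filterᵇ p (g (f 0) ++ rest))
    ≡⟨ cong (+_ ∘ length) (List.filter-++ (T? ∘ p) (g (f 0)) rest) ⟩
  + length (filterᵇ p (g (f 0)) ++ filterᵇ p rest)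
    ≡⟨ cong +_ (List.length-++ (filterᵇ p (g (f 0)))) ⟩
  + (length (filterᵇ p (g (f 0))) + length (filterᵇ p rest))
    ≡⟨ ℤ.pos-+ (length (filterᵇ p (g (f 0)))) _ ⟩
  + length (filterᵇ p (g (f 0))) +ℤ + length (filterᵇ p rest)
    ≡⟨ cong (+ length (filterᵇ p (g (f 0))) +ℤ_) (length-filterᵇ-concatMap p g M (f ∘ suc)) ⟩
  + length (filterᵇ p (g (f 0))) +ℤ Σ≤ M (λ x → + length (filterᵇ p (g (f (suc x)))))
    ≡⟨ Σ≤-suc M (λ x → + length (filterᵇ p (g (f x)))) ⟨
  Σ≤ (suc M) (λ x → + length (filterᵇ p (g (f x)))) ∎
  where
  open ≡-Reasoning
  rest : List (List ℕ)
  rest = concatMap g (applyUpTo (f ∘ suc) (suc M))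

length-filterᵇ-allSeqs : ∀ m M (p : List ℕ → Bool) →
  + length (filterᵇ p (allSeqs m M)) ≡ Σseq m M (λ L → ⟦ p L ⟧)
length-filterᵇ-allSeqs zero M p with p []
... | true  = refl
... | false = refl
length-filterᵇ-allSeqs (suc m) M p = begin
  + length (filterᵇ p (concatMap (λ x → map (x ∷_) (allSeqs m M)) (applyUpTo (λ x → x) (suc M))))
    ≡⟨ length-filterᵇ-concatMap p (λ x → map (x ∷_) (allSeqs m M)) M (λ x → x) ⟩
  Σ≤ M (λ x → + length (filterᵇ p (map (x ∷_) (allSeqs m M))))
    ≡⟨ Σ≤-cong M (λ x _ → trans (cong +_ (length-filterᵇ-map p (x ∷_) (allSeqs m M)))
                                (length-filterᵇ-allSeqs m M (λ L → p (x ∷ L)))) ⟩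
  Σ≤ M (λ x → Σseq m M (λ L → ⟦ p (x ∷ L) ⟧)) ∎
  where open ≡-Reasoning

count : ℕ → {P : Pred (List ℕ) 0ℓ} → Decidable P → FPS
count M P? m n = Σseq m M (λ L → ⟦ (sum L ≡ᵇ n) ∧ does (P? L) ⟧)

⟦∧⟧-reject : ∀ b {P : Set} (P? : Dec P) → ¬ P → ⟦ b ∧ does P? ⟧ ≡ 0ℤ
⟦∧⟧-reject b P? ¬p = trans (cong (λ c → ⟦ b ∧ c ⟧) (dec-false P? ¬p)) (cong ⟦_⟧ (∧-zeroʳ b))

-- On sequences with entries ≤ M, X is the disjoint union of Y and of β followed by Z.
record Splitting (M : ℕ) (β : List ℕ) (X Y Z : Pred (List ℕ) 0ℓ) : Set where
  field
    prefixed   : ∀ r → All (_≤ M) r → X (β ++ r) ⇔ Z r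
    excluded   : ∀ r → ¬ Y (β ++ r)
    unprefixed : ∀ L → All (_≤ M) L → ¬ Prefix _≡_ β L → X L ⇔ Y L

+≡⇔≡∸ : ∀ {s t n} → s ≤ n → (s + t ≡ n) ⇔ (t ≡ n ∸ s)
+≡⇔≡∸ s≤n = mk⇔ (λ s+t≡n → sym (Equivalence.to (≡+⇔∸≡ s≤n) (sym s+t≡n)))
                (λ t≡n∸s → sym (Equivalence.from (≡+⇔∸≡ s≤n) (sym t≡n∸s)))

Σseq-prefix-shift : ∀ {M β Z} (Z? : Decidable Z) → All (_≤ M) β → ∀ m n (h : List ℕ → ℤ) →
  (∀ L → All (_≤ M) L → ¬ Prefix _≡_ β L → h L ≡ 0ℤ) →
  (∀ r → All (_≤ M) r → h (β ++ r) ≡ ⟦ (sum (β ++ r) ≡ᵇ n) ∧ does (Z? r) ⟧) →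
  Σseq m M h ≡ shift (length β) (sum β) (count M Z?) m n
Σseq-prefix-shift {M} {β} Z? β≤M m n h h-unprefixed h-prefixed with length β ≤? m
... | no |β|≰m = trans
  (Σseq-zero m M (λ L |L|≡m L≤M →
    h-unprefixed L L≤M (λ β≼L → |β|≰m (subst (length β ≤_) |L|≡m (length-mono β≼L)))))
  (sym (shift-≰ {length β} {sum β} {m} {n} (count M Z?) (|β|≰m ∘ proj₁)))
... | yes |β|≤m = begin
  Σseq m M h
    ≡⟨ Σseq-prefix β h β≤M |β|≤m h-unprefixed ⟩
  Σseq k M (λ r → h (β ++ r))
    ≡⟨ Σseq-cong k M (λ r _ r≤M →
         trans (h-prefixed r r≤M) (cong (λ s → ⟦ (s ≡ᵇ n) ∧ does (Z? r) ⟧) (sum-++ β r))) ⟩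
  Σseq k M (λ r → ⟦ (sum β + sum r ≡ᵇ n) ∧ does (Z? r) ⟧)
    ≡⟨ by-sum-β ⟩
  shift (length β) (sum β) (count M Z?) m n ∎
  where
  open ≡-Reasoning
  k : ℕ
  k = m ∸ length β
  by-sum-β : Σseq k M (λ r → ⟦ (sum β + sum r ≡ᵇ n) ∧ does (Z? r) ⟧) ≡
             shift (length β) (sum β) (count M Z?) m n
  by-sum-β with sum β ≤? n
  ... | yes Σβ≤n = trans
    (Σseq-cong k M (λ r _ _ → cong (λ b → ⟦ b ∧ does (Z? r) ⟧)
      (does-⇔ (+≡⇔≡∸ Σβ≤n) (sum β + sum r ≟ n) (sum r ≟ n ∸ sum β))))
    (sym (shift-≤ {length β} {sum β} {m} {n} (count M Z?) |β|≤m Σβ≤n))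
  ... | no Σβ≰n = trans
    (Σseq-zero k M (λ r _ _ → cong (λ b → ⟦ b ∧ does (Z? r) ⟧)
      (dec-false (sum β + sum r ≟ n) (λ e → Σβ≰n (subst (sum β ≤_) e (ℕ.m≤m+n (sum β) (sum r)))))))
    (sym (shift-≰ {length β} {sum β} {m} {n} (count M Z?) (Σβ≰n ∘ proj₂)))

count-split : ∀ {M β s X Y Z} (X? : Decidable X) (Y? : Decidable Y) (Z? : Decidable Z) →
  All (_≤ M) β → sum β ≡ s → Splitting M β X Y Z →
  count M X? ≋ count M Y? ⊕ shift (length β) s (count M Z?)
count-split {M} {β} X? Y? Z? β≤M refl split m n = begin
  count M X? m n
    ≡⟨ Σseq-cong m M (λ L _ _ → x≡y+[x-y] (χ X? L) (χ Y? L)) ⟩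
  Σseq m M (λ L → χ Y? L +ℤ Δ L)
    ≡⟨ Σseq-distrib-+ m M (χ Y?) Δ ⟩
  count M Y? m n +ℤ Σseq m M Δ
    ≡⟨ cong (count M Y? m n +ℤ_) (Σseq-prefix-shift Z? β≤M m n Δ Δ-unprefixed Δ-prefixed) ⟩
  count M Y? m n +ℤ shift (length β) (sum β) (count M Z?) m n ∎
  where
  open ≡-Reasoning
  open Splitting split

  x≡y+[x-y] : ∀ x y → x ≡ y +ℤ (x -ℤ y)
  x≡y+[x-y] = solve-∀

  χ : ∀ {P : Pred (List ℕ) 0ℓ} → Decidable P → List ℕ → ℤ
  χ P? L = ⟦ (sum L ≡ᵇ n) ∧ does (P? L) ⟧

  Δ : List ℕ → ℤ
  Δ L = χ X? L -ℤ χ Y? L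

  Δ-unprefixed : ∀ L → All (_≤ M) L → ¬ Prefix _≡_ β L → Δ L ≡ 0ℤ
  Δ-unprefixed L L≤M ¬β≼L = ℤ.i≡j⇒i-j≡0
    (cong (λ b → ⟦ (sum L ≡ᵇ n) ∧ b ⟧) (does-⇔ (unprefixed L L≤M ¬β≼L) (X? L) (Y? L)))

  Δ-prefixed : ∀ r → All (_≤ M) r → Δ (β ++ r) ≡ ⟦ (sum (β ++ r) ≡ᵇ n) ∧ does (Z? r) ⟧
  Δ-prefixed r r≤M = begin
    χ X? (β ++ r) -ℤ χ Y? (β ++ r)
      ≡⟨ cong₂ (λ b c → ⟦ (sum (β ++ r) ≡ᵇ n) ∧ b ⟧ -ℤ c)
               (does-⇔ (prefixed r r≤M) (X? (β ++ r)) (Z? r)) (⟦∧⟧-reject _ (Y? (β ++ r)) (excluded r)) ⟩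
    ⟦ (sum (β ++ r) ≡ᵇ n) ∧ does (Z? r) ⟧ -ℤ 0ℤ
      ≡⟨ ℤ.+-identityʳ _ ⟩
    ⟦ (sum (β ++ r) ≡ᵇ n) ∧ does (Z? r) ⟧ ∎

count-All≤ : ∀ {M P} (P? : Decidable P) → count (suc M) (λ L → P? L ×-dec all? (_≤? M) L) ≋ count M P?
count-All≤ {M} P? m n = trans
  (Σseq-restrict m M _ (λ L _ ¬L≤M → ⟦∧⟧-reject (sum L ≡ᵇ n) (P? L ×-dec all? (_≤? M) L) (¬L≤M ∘ proj₂)))
  (Σseq-cong m M (λ L _ L≤M → cong (λ b → ⟦ (sum L ≡ᵇ n) ∧ b ⟧)
    (does-⇔ (mk⇔ proj₁ (_, L≤M)) (P? L ×-dec all? (_≤? M) L) (P? L))))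

All≤sum : ∀ L → All (_≤ sum L) L
All≤sum []      = []
All≤sum (x ∷ L) = ℕ.m≤m+n x (sum L) ∷ All.map (λ y≤ → ℕ.≤-trans y≤ (ℕ.m≤n+m (sum L) x)) (All≤sum L)

count-suc-bound : ∀ {P} (P? : Decidable P) m n → count (suc n) P? m n ≡ count n P? m n
count-suc-bound P? m n = Σseq-restrict m n _ (λ L _ ¬L≤n →
  cong (λ b → ⟦ b ∧ does (P? L) ⟧)
       (dec-false (sum L ≟ n) (λ ΣL≡n → ¬L≤n (subst (λ s → All (_≤ s) L) ΣL≡n (All≤sum L)))))

-- 001-partitions

≤-squeeze : ∀ {x y N} → x ≤ N → y ≤ suc x → y ≡ suc N → N ≡ x
≤-squeeze x≤N y≤1+x refl = ℕ.≤-antisym (ℕ.≤-pred y≤1+x) x≤N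

m≤1+n∧m≢1+n⇒m≤n : ∀ {x N} → x ≤ suc N → x ≢ suc N → x ≤ N
m≤1+n∧m≢1+n⇒m≤n x≤1+N x≢1+N = ℕ.m<1+n⇒m≤n (ℕ.≤∧≢⇒< x≤1+N x≢1+N)

HeadLe : ℕ → List ℕ → Set
HeadLe b []      = ⊤
HeadLe b (x ∷ _) = x ≤ b

headLe? : ∀ b → Decidable (HeadLe b)
headLe? b []      = yes tt
headLe? b (x ∷ _) = x ≤? b

HeadLe-≤ : ∀ {b c} L → b ≤ c → HeadLe b L → HeadLe c L
HeadLe-≤ []      b≤c _   = tt
HeadLe-≤ (x ∷ _) b≤c x≤b = ℕ.≤-trans x≤b b≤c

All⇒HeadLe : ∀ {b} i L → All (_≤ b) L → HeadLe b (drop i L)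
All⇒HeadLe i L L≤b with drop i L | drop⁺ i L≤b
... | []    | _         = tt
... | _ ∷ _ | x≤b ∷ _   = x≤b

Local : ℕ → List ℕ → Set
Local a r = HeadLe (suc a) r × HeadLe (suc a) (drop 1 r) × HeadLe a (drop 2 r)

Local-bounded : ∀ {a} r → All (_≤ a) r → Local a r
Local-bounded r r≤a = HeadLe-≤ r (ℕ.n≤1+n _) (All⇒HeadLe 0 r r≤a)
                    , HeadLe-≤ (drop 1 r) (ℕ.n≤1+n _) (All⇒HeadLe 1 r r≤a)
                    , All⇒HeadLe 2 r r≤a

Gaps : List ℕ → Set
Gaps []      = ⊤
Gaps (a ∷ r) = Local a r × Gaps r

T-≤ᵇ-∧ : ∀ {m n b} → T ((m ≤ᵇ n) ∧ b) ⇔ (m ≤ n × T b)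
T-≤ᵇ-∧ = ⇔-trans T-∧ (mk⇔ (ℕ.≤ᵇ⇒≤ _ _) ℕ.≤⇒≤ᵇ ×-⇔ ⇔-refl)

gapsOK⇔Gaps : ∀ L → T (gapsOK L) ⇔ Gaps L
gapsOK⇔Gaps []                  = mk⇔ _ _
gapsOK⇔Gaps (a ∷ [])            = mk⇔ _ _
gapsOK⇔Gaps (a ∷ b ∷ [])        =
  mk⇔ (λ b≤ → (ℕ.≤ᵇ⇒≤ b (suc a) b≤ , _) , _) (λ ((b≤ , _) , _) → ℕ.≤⇒≤ᵇ b≤)
gapsOK⇔Gaps (a ∷ b ∷ c ∷ [])    = mk⇔
  (λ t → let b≤ , t′ = to T-≤ᵇ-∧ t ; c≤ , g = to T-≤ᵇ-∧ t′
         in (b≤ , c≤ , _) , to (gapsOK⇔Gaps (b ∷ c ∷ [])) g)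
  (λ ((b≤ , c≤ , _) , g) → from T-≤ᵇ-∧ (b≤ , from T-≤ᵇ-∧ (c≤ , from (gapsOK⇔Gaps (b ∷ c ∷ [])) g)))
  where open Equivalence
gapsOK⇔Gaps (a ∷ b ∷ c ∷ d ∷ r) = mk⇔
  (λ t → let b≤ , t′ = to T-≤ᵇ-∧ t ; c≤ , t″ = to T-≤ᵇ-∧ t′ ; d≤ , g = to T-≤ᵇ-∧ t″
         in (b≤ , c≤ , d≤) , to (gapsOK⇔Gaps (b ∷ c ∷ d ∷ r)) g)
  (λ ((b≤ , c≤ , d≤) , g) →
     from T-≤ᵇ-∧ (b≤ , from T-≤ᵇ-∧ (c≤ , from T-≤ᵇ-∧ (d≤ , from (gapsOK⇔Gaps (b ∷ c ∷ d ∷ r)) g))))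
  where open Equivalence

Valid : Pred (List ℕ) 0ℓ
Valid L = T (lastPos L) × Gaps L

-- decided through T? so that does (valid? L) is definitionally lastPos L ∧ gapsOK L, the test in is001
valid? : Decidable Valid
valid? L = Dec.map (⇔-trans T-∧ (⇔-refl ×-⇔ gapsOK⇔Gaps L)) (T? (lastPos L ∧ gapsOK L))

lastPos-suc : ∀ a r → lastPos (suc a ∷ r) ≡ lastPos r
lastPos-suc a []      = refl
lastPos-suc a (_ ∷ _) = refl

¬lastPos-zeros : ∀ L → All (_≤ 0) L → ¬ T (lastPos (0 ∷ L))
¬lastPos-zeros []      []          = λ ()
¬lastPos-zeros (_ ∷ L) (z≤n ∷ L≤0) = ¬lastPos-zeros L L≤0

Gaps⇒All≤ : ∀ {N} L → Gaps L → HeadLe N L → HeadLe N (drop 1 L) → HeadLe N (drop 2 L) → All (_≤ N) L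
Gaps⇒All≤ []      _                  _   _  _  = []
Gaps⇒All≤ (x ∷ r) ((_ , _ , h₃) , g) x≤N h₁ h₂ = x≤N ∷ Gaps⇒All≤ r g h₁ h₂ (HeadLe-≤ (drop 2 r) x≤N h₃)

count-zero : count 0 valid? ≋ one
count-zero zero    zero    = refl
count-zero zero    (suc n) = refl
count-zero (suc m) n       = Σseq-zero m 0 (λ L _ L≤0 →
  ⟦∧⟧-reject (sum L ≡ᵇ n) (valid? (0 ∷ L)) (¬lastPos-zeros L L≤0 ∘ proj₁))

-- Entries bounded by N + 1

module Factorisation (N : ℕ) where

  b₁ b₂ b₃ b₃′ : List ℕ
  b₁  = suc N ∷ []
  b₂  = N ∷ suc N ∷ []
  b₃  = N ∷ N ∷ suc N ∷ []
  b₃′ = N ∷ suc N ∷ suc N ∷ []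

  ValidLow₁ ValidLow₁′ ValidLow₂ ValidLow : Pred (List ℕ) 0ℓ
  ValidLow₁  L = Valid L × HeadLe N L
  ValidLow₁′ L = ValidLow₁ L × ¬ Prefix _≡_ b₃′ L
  ValidLow₂  L = ValidLow₁ L × HeadLe N (drop 1 L)
  ValidLow   L = Valid L × All (_≤ N) L

  validLow₁? : Decidable ValidLow₁
  validLow₁? L = valid? L ×-dec headLe? N L

  validLow₁′? : Decidable ValidLow₁′
  validLow₁′? L = validLow₁? L ×-dec ¬? (prefix? _≟_ b₃′ L)

  validLow₂? : Decidable ValidLow₂
  validLow₂? L = validLow₁? L ×-dec headLe? N (drop 1 L)

  validLow? : Decidable ValidLow
  validLow? L = valid? L ×-dec all? (_≤? N) L

  -- In each prefixed case, Valid (β ++ r) unfolds to the local conditions at the entries of β and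
  -- Valid r; the former say exactly which leading entries of r are ≤ N, or hold by the bound.
  split-b₁ : Splitting (suc N) b₁ Valid ValidLow₁ Valid
  split-b₁ = record
    { prefixed   = λ r r≤ → mk⇔
        (λ (lp , _ , g) → subst T (lastPos-suc N r) lp , g)
        (λ (lp , g) → subst T (sym (lastPos-suc N r)) lp , Local-bounded r r≤ , g)
    ; excluded   = λ _ (_ , 1+N≤N) → ℕ.1+n≰n 1+N≤N
    ; unprefixed = unprefixed
    }
    where
    unprefixed : ∀ L → All (_≤ suc N) L → ¬ Prefix _≡_ b₁ L → Valid L ⇔ ValidLow₁ L
    unprefixed []      _            _     = mk⇔ (_, tt) proj₁
    unprefixed (x ∷ r) (x≤1+N ∷ _) ¬b₁≼L =
      mk⇔ (λ v → v , m≤1+n∧m≢1+n⇒m≤n x≤1+N (λ x≡1+N → ¬b₁≼L (sym x≡1+N ∷ []))) proj₁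

  split-b₃′ : Splitting (suc N) b₃′ ValidLow₁ ValidLow₁′ ValidLow₁
  split-b₃′ = record
    { prefixed   = λ r r≤ → mk⇔
        (λ ((lp , (_ , _ , h₀) , _ , _ , g) , _) → (subst T (lastPos-suc N r) lp , g) , h₀)
        (λ ((lp , g) , h₀) → ( subst T (sym (lastPos-suc N r)) lp
                             , (ℕ.≤-refl , ℕ.≤-refl , h₀) , Local-bounded (suc N ∷ r) (ℕ.≤-refl ∷ r≤)
                             , Local-bounded r r≤ , g)
                           , ℕ.≤-refl)
    ; excluded   = λ _ (_ , ¬b₃′≼) → ¬b₃′≼ (refl ∷ refl ∷ refl ∷ [])
    ; unprefixed = λ _ _ ¬b₃′≼L → mk⇔ (_, ¬b₃′≼L) proj₁
    }

  split-b₂ : Splitting (suc N) b₂ ValidLow₁′ ValidLow₂ ValidLow₂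
  split-b₂ = record
    { prefixed   = λ r r≤ → mk⇔
        (λ (((lp , (_ , _ , h₁) , _ , g) , _) , ¬b₃′≼) →
           ((subst T (lastPos-suc N r) lp , g) , head≤N r r≤ ¬b₃′≼) , h₁)
        (λ (((lp , g) , h₀) , h₁) →
           ( ( subst T (sym (lastPos-suc N r)) lp
             , (ℕ.≤-refl , All⇒HeadLe 0 r r≤ , h₁) , Local-bounded r r≤ , g)
           , ℕ.≤-refl)
           , ¬b₃′≼-third (N ∷ suc N ∷ r) h₀)
    ; excluded   = λ _ (_ , 1+N≤N) → ℕ.1+n≰n 1+N≤N
    ; unprefixed = λ L L≤ ¬b₂≼L → mk⇔
        (λ (v , _) → v , second≤N L L≤ ¬b₂≼L v)
        (λ (v , h₁) → v , ¬b₃′≼-second L h₁)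
    }
    where
    head≤N : ∀ r → All (_≤ suc N) r → ¬ Prefix _≡_ b₃′ (N ∷ suc N ∷ r) → HeadLe N r
    head≤N []      _            _     = tt
    head≤N (x ∷ _) (x≤1+N ∷ _) ¬b₃′≼ =
      m≤1+n∧m≢1+n⇒m≤n x≤1+N (λ x≡1+N → ¬b₃′≼ (refl ∷ refl ∷ sym x≡1+N ∷ []))
    ¬b₃′≼-second : ∀ L → HeadLe N (drop 1 L) → ¬ Prefix _≡_ b₃′ L
    ¬b₃′≼-second (_ ∷ y ∷ _) y≤N (_ ∷ 1+N≡y ∷ _) = ℕ.1+n≰n (subst (_≤ N) (sym 1+N≡y) y≤N)
    ¬b₃′≼-third : ∀ L → HeadLe N (drop 2 L) → ¬ Prefix _≡_ b₃′ L
    ¬b₃′≼-third (_ ∷ _ ∷ z ∷ _) z≤N (_ ∷ _ ∷ 1+N≡z ∷ _) = ℕ.1+n≰n (subst (_≤ N) (sym 1+N≡z) z≤N)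
    second≤N : ∀ L → All (_≤ suc N) L → ¬ Prefix _≡_ b₂ L → ValidLow₁ L → HeadLe N (drop 1 L)
    second≤N []          _                _     _ = tt
    second≤N (_ ∷ [])    _                _     _ = tt
    second≤N (x ∷ y ∷ _) (_ ∷ y≤1+N ∷ _) ¬b₂≼L ((_ , (y≤1+x , _) , _) , x≤N) =
      m≤1+n∧m≢1+n⇒m≤n y≤1+N (λ y≡1+N → ¬b₂≼L (≤-squeeze x≤N y≤1+x y≡1+N ∷ sym y≡1+N ∷ []))

  split-b₃ : Splitting (suc N) b₃ ValidLow₂ ValidLow ValidLow₂
  split-b₃ = record
    { prefixed   = λ r r≤ → mk⇔
        (λ (((lp , (_ , _ , h₀) , (_ , _ , h₁) , _ , g) , _) , _) →
           ((subst T (lastPos-suc N r) lp , g) , h₀) , h₁)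
        (λ (((lp , g) , h₀) , h₁) →
           (( subst T (sym (lastPos-suc N r)) lp
            , (ℕ.n≤1+n N , ℕ.≤-refl , h₀) , (ℕ.≤-refl , All⇒HeadLe 0 r r≤ , h₁) , Local-bounded r r≤ , g)
           , ℕ.≤-refl)
           , ℕ.≤-refl)
    ; excluded   = λ { _ (_ , _ ∷ _ ∷ 1+N≤N ∷ _) → ℕ.1+n≰n 1+N≤N }
    ; unprefixed = λ L L≤ ¬b₃≼L → mk⇔
        (λ (((lp , g) , h₀) , h₁) → (lp , g) , Gaps⇒All≤ L g h₀ h₁ (third≤N L L≤ ¬b₃≼L g h₀ h₁))
        (λ (v , L≤N) → (v , All⇒HeadLe 0 L L≤N) , All⇒HeadLe 1 L L≤N)
    }
    where
    third≤N : ∀ L → All (_≤ suc N) L → ¬ Prefix _≡_ b₃ L →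
              Gaps L → HeadLe N L → HeadLe N (drop 1 L) → HeadLe N (drop 2 L)
    third≤N []              _ _ _ _ _ = tt
    third≤N (_ ∷ [])        _ _ _ _ _ = tt
    third≤N (_ ∷ _ ∷ [])    _ _ _ _ _ = tt
    third≤N (x ∷ y ∷ z ∷ _) (_ ∷ _ ∷ z≤1+N ∷ _) ¬b₃≼L ((_ , z≤1+x , _) , (z≤1+y , _) , _) x≤N y≤N =
      m≤1+n∧m≢1+n⇒m≤n z≤1+N (λ z≡1+N →
        ¬b₃≼L (≤-squeeze x≤N z≤1+x z≡1+N ∷ ≤-squeeze y≤N z≤1+y z≡1+N ∷ sym z≡1+N ∷ []))

  sum-b₁ : sum b₁ ≡ N + 1
  sum-b₁ = trans (cong suc (ℕ.+-identityʳ N)) (ℕ.+-comm 1 N)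

  sum-b₂ : sum b₂ ≡ 2 * N + 1
  sum-b₂ = trans (ℕ.+-suc N (N + 0)) (ℕ.+-comm 1 (2 * N))

  sum-b₃ : sum b₃ ≡ 3 * N + 1
  sum-b₃ = trans (cong (λ k → N + k) (ℕ.+-suc N (N + 0))) (trans (ℕ.+-suc N _) (ℕ.+-comm 1 (3 * N)))

  sum-b₃′ : sum b₃′ ≡ 3 * N + 2
  sum-b₃′ = trans (ℕ.+-suc N _) (trans (cong suc sum-b₃) (sym (ℕ.+-suc (3 * N) 1)))

  0<N+1 : 0 < N + 1
  0<N+1 = ℕ.m≤n+m 1 N

  0<3N+1 : 0 < 3 * N + 1
  0<3N+1 = ℕ.m≤n+m 1 (3 * N)

  0<3N+2 : 0 < 3 * N + 2
  0<3N+2 = ℕ.<-≤-trans z<s (ℕ.m≤n+m 2 (3 * N))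

  G₁ O₂ G₃ G₃′ : FPS
  G₁  = geom 1 (N + 1)
  O₂  = onePlus 2 (2 * N + 1)
  G₃  = geom 3 (3 * N + 1)
  G₃′ = geom 3 (3 * N + 2)

  count-validLow₂ : count (suc N) validLow₂? ≋ count N valid? ⊛ G₃
  count-validLow₂ =
    shift-fixpoint⇒⊛-geom 3 (3 * N + 1) (count (suc N) validLow₂?) (count N valid?) 0<3N+1 (begin
      count (suc N) validLow₂?
        ≈⟨ count-split validLow₂? validLow? validLow₂? (ℕ.n≤1+n N ∷ ℕ.n≤1+n N ∷ ℕ.≤-refl ∷ []) sum-b₃ split-b₃ ⟩
      count (suc N) validLow? ⊕ shift 3 (3 * N + 1) (count (suc N) validLow₂?)
        ≈⟨ ⊕-cong {g = shift 3 (3 * N + 1) (count (suc N) validLow₂?)} (count-All≤ valid?) (λ _ _ → refl) ⟩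
      count N valid? ⊕ shift 3 (3 * N + 1) (count (suc N) validLow₂?) ∎)
    where open ≋-Reasoning

  count-validLow₁′ : count (suc N) validLow₁′? ≋ count (suc N) validLow₂? ⊛ O₂
  count-validLow₁′ = begin
    count (suc N) validLow₁′?
      ≈⟨ count-split validLow₁′? validLow₂? validLow₂? (ℕ.n≤1+n N ∷ ℕ.≤-refl ∷ []) sum-b₂ split-b₂ ⟩
    count (suc N) validLow₂? ⊕ shift 2 (2 * N + 1) (count (suc N) validLow₂?)
      ≈⟨ ⊛-onePlus 2 (2 * N + 1) (count (suc N) validLow₂?) ⟨
    count (suc N) validLow₂? ⊛ O₂ ∎
    where open ≋-Reasoning

  count-validLow₁ : count (suc N) validLow₁? ≋ count (suc N) validLow₁′? ⊛ G₃′
  count-validLow₁ =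
    shift-fixpoint⇒⊛-geom 3 (3 * N + 2) (count (suc N) validLow₁?) (count (suc N) validLow₁′?) 0<3N+2
    (count-split validLow₁? validLow₁′? validLow₁? (ℕ.n≤1+n N ∷ ℕ.≤-refl ∷ ℕ.≤-refl ∷ []) sum-b₃′ split-b₃′)

  count-valid : count (suc N) valid? ≋ count (suc N) validLow₁? ⊛ G₁
  count-valid = shift-fixpoint⇒⊛-geom 1 (N + 1) (count (suc N) valid?) (count (suc N) validLow₁?) 0<N+1
    (count-split valid? validLow₁? valid? (ℕ.≤-refl ∷ []) sum-b₁ split-b₁)

  ⊛-rhsFactor : ∀ f → f ⊛ rhsFactor N ≋ (((f ⊛ G₃) ⊛ O₂) ⊛ G₃′) ⊛ G₁
  ⊛-rhsFactor f = begin
    f ⊛ (((O₂ ⊛ G₁) ⊛ G₃) ⊛ G₃′)      ≈⟨ assoc-G₃′ f ((O₂ ⊛ G₁) ⊛ G₃) ⟩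
    (f ⊛ ((O₂ ⊛ G₁) ⊛ G₃)) ⊛ G₃′      ≈⟨ ⊛-congˡ G₃′ (assoc-G₃ f (O₂ ⊛ G₁)) ⟩
    ((f ⊛ (O₂ ⊛ G₁)) ⊛ G₃) ⊛ G₃′      ≈⟨ ⊛-congˡ G₃′ (⊛-congˡ G₃ (assoc-G₁ f O₂)) ⟩
    (((f ⊛ O₂) ⊛ G₁) ⊛ G₃) ⊛ G₃′      ≈⟨ ⊛-congˡ G₃′ (⊛-swap G₁ G₃ assoc-G₁ assoc-G₃ (f ⊛ O₂)) ⟩
    (((f ⊛ O₂) ⊛ G₃) ⊛ G₁) ⊛ G₃′      ≈⟨ ⊛-congˡ G₃′ (⊛-congˡ G₁ (⊛-swap O₂ G₃ assoc-O₂ assoc-G₃ f)) ⟩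
    (((f ⊛ G₃) ⊛ O₂) ⊛ G₁) ⊛ G₃′      ≈⟨ ⊛-swap G₁ G₃′ assoc-G₁ assoc-G₃′ ((f ⊛ G₃) ⊛ O₂) ⟩
    (((f ⊛ G₃) ⊛ O₂) ⊛ G₃′) ⊛ G₁      ∎
    where
    open ≋-Reasoning
    assoc-G₁ : RightAssociative G₁
    assoc-G₁ = geom-rightAssociative 1 (N + 1) 0<N+1
    assoc-O₂ : RightAssociative O₂
    assoc-O₂ = onePlus-rightAssociative 2 (2 * N + 1)
    assoc-G₃ : RightAssociative G₃
    assoc-G₃ = geom-rightAssociative 3 (3 * N + 1) 0<3N+1
    assoc-G₃′ : RightAssociative G₃′
    assoc-G₃′ = geom-rightAssociative 3 (3 * N + 2) 0<3N+2

  count-suc : count (suc N) valid? ≋ count N valid? ⊛ rhsFactor N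
  count-suc = begin
    count (suc N) valid?                                ≈⟨ count-valid ⟩
    count (suc N) validLow₁? ⊛ G₁                       ≈⟨ ⊛-congˡ G₁ count-validLow₁ ⟩
    (count (suc N) validLow₁′? ⊛ G₃′) ⊛ G₁              ≈⟨ ⊛-congˡ G₁ (⊛-congˡ G₃′ count-validLow₁′) ⟩
    ((count (suc N) validLow₂? ⊛ O₂) ⊛ G₃′) ⊛ G₁        ≈⟨ ⊛-congˡ G₁ (⊛-congˡ G₃′ (⊛-congˡ O₂ count-validLow₂)) ⟩
    (((count N valid? ⊛ G₃) ⊛ O₂) ⊛ G₃′) ⊛ G₁           ≈⟨ ⊛-rhsFactor (count N valid?) ⟨
    count N valid? ⊛ rhsFactor N                        ∎
    where open ≋-Reasoning

prodUpTo-rhsFactor : ∀ N → prodUpTo N rhsFactor ≋ count N valid?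
prodUpTo-rhsFactor zero    m n = sym (count-zero m n)
prodUpTo-rhsFactor (suc N) = begin
  prodUpTo N rhsFactor ⊛ rhsFactor N   ≈⟨ ⊛-congˡ (rhsFactor N) (prodUpTo-rhsFactor N) ⟩
  count N valid? ⊛ rhsFactor N         ≈⟨ Factorisation.count-suc N ⟨
  count (suc N) valid?                 ∎
  where open ≋-Reasoning

theorem27 : (m n : ℕ) → + (J'' m n) ≡ rhs m n
theorem27 m n = begin
  + J'' m n                  ≡⟨ length-filterᵇ-allSeqs m n (is001 n) ⟩
  count n valid? m n         ≡⟨ count-suc-bound valid? m n ⟨
  count (suc n) valid? m n   ≡⟨ prodUpTo-rhsFactor (suc n) m n ⟨
  rhs m n                    ∎
  where open ≡-Reasoning
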